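{- Let $l>1$ be an integer and $n\in l\mathbb{Z}^+$. Then $\log_l n\leq\|n\|_l\leq l\log_l n-1$.
   Context: For a positive integer $l$ and $n\in l\mathbb{Z}^+$, the $l$-complexity $\|n\|_l$ is the minimal number of copies of $l$ needed to express $n$ from $l$ using only addition and multiplication (and parentheses). Equivalently, $\|l\|_l=1$ and $\|n\|_l=\min(\|a\|_l+\|b\|_l)$, the minimum over $a,b\in l\mathbb{Z}^+$ with $a+b=n$ or $ab=n$. -}

module Defs where

open import Data.Nat using (ℕ; zero; suc; _+_; _*_; _≤_)
open import Data.Product using (Σ; _×_)
open import Relation.Binary.PropositionalEquality using (_≡_)

data Expr : Set where
  leaf : Expr
  add  : Expr → Expr → Expr
  mul  : Expr → Expr → Expr

eval : ℕ → Expr → ℕ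
eval l leaf      = l
eval l (add e f) = eval l e + eval l f
eval l (mul e f) = eval l e * eval l f

copies : Expr → ℕ
copies leaf      = 1
copies (add e f) = copies e + copies f
copies (mul e f) = copies e + copies f

-- IsComplexity l n k  :  k = ‖n‖_l, the minimal number of copies of l
-- needed to express n.
IsComplexity : ℕ → ℕ → ℕ → Set
IsComplexity l n k =
  Σ Expr (λ e → eval l e ≡ n × copies e ≡ k)
  × (∀ (e : Expr) → eval l e ≡ n → k ≤ copies e)

-- Lower bound: an expression with c copies of l has value at most l ^ c,
-- because x + y ≤ x y for x, y ≥ 2.  Upper bound: by Horner's scheme, if
-- m = r + q l with r < l, then m l = l + ⋯ + l (r times) + l (q l), which
-- uses at most l more copies than an expression for q l; since
-- l ^ l (q l) ^ l ≤ (m l) ^ l, the invariant l ^ (copies + 1) ≤ n ^ l passes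
-- from q l to m l.  The minimum ‖n‖ exists because only finitely many
-- expressions use at most a given number of copies.
module Submission where

open import Defs
open import Data.Nat using (ℕ; _<_; _≤_; _+_; _^_)
open import Data.Nat.Divisibility using (_∣_)
open import Data.Product using (Σ; _×_)

open import Data.Nat using (zero; suc; _*_; s≤s; s≤s⁻¹; z<s; _≟_; _≤?_; _<?_)
open import Data.Nat.Properties
open import Data.Nat.DivMod using (_/_; _%_; m≡m%n+[m/n]*n; m%n<n; m/n<m; m≥n⇒m/n>0)
open import Data.Nat.Divisibility using (divides)
open import Data.Nat.Induction using (<-rec)
open import Data.Product using (∃; _,_)
open import Data.List using (List; []; _∷_; _++_; cartesianProductWith; filter)
open import Data.List.Extrema.Nat using (argmin; argmin-all; f[argmin]≤f[xs]; f[argmin]≤f[⊤])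
open import Data.List.Membership.Propositional using (_∈_)
open import Data.List.Membership.Propositional.Properties
  using (∈-++⁺ˡ; ∈-++⁺ʳ; ∈-cartesianProductWith⁺; ∈-filter⁺)
open import Data.List.Relation.Unary.All using (lookup)
open import Data.List.Relation.Unary.All.Properties using (all-filter)
open import Data.List.Relation.Unary.Any using (here; there)
open import Relation.Binary.PropositionalEquality
open import Relation.Nullary using (yes; no; contradiction)
open import Relation.Unary using (Pred; Decidable)

m+n≤m*n : ∀ {m n} → 2 ≤ m → 2 ≤ n → m + n ≤ m * n
m+n≤m*n {suc m} {n} (s≤s 1≤m) 2≤n = begin
  suc m + n   ≡⟨ +-comm (suc m) n ⟩
  n + suc m   ≤⟨ +-monoʳ-≤ n 1+m≤m*n ⟩
  n + m * n   ∎
  where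
  open ≤-Reasoning
  1+m≤m*n : suc m ≤ m * n
  1+m≤m*n = begin
    suc m    ≤⟨ +-monoˡ-≤ m 1≤m ⟩
    m + m    ≡⟨ cong (m +_) (sym (+-identityʳ m)) ⟩
    2 * m    ≡⟨ *-comm 2 m ⟩
    m * 2    ≤⟨ *-monoʳ-≤ m 2≤n ⟩
    m * n    ∎

^-distrib-* : ∀ m n o → (m * n) ^ o ≡ m ^ o * n ^ o
^-distrib-* m n zero    = refl
^-distrib-* m n (suc o) = begin
  m * n * (m * n) ^ o      ≡⟨ cong (m * n *_) (^-distrib-* m n o) ⟩
  m * n * (m ^ o * n ^ o)  ≡⟨ [m*n]*[o*p]≡[m*o]*[n*p] m n (m ^ o) (n ^ o) ⟩
  m * m ^ o * (n * n ^ o)  ∎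
  where open ≡-Reasoning

copies>0 : ∀ e → 0 < copies e
copies>0 leaf      = z<s
copies>0 (add e f) = <-≤-trans (copies>0 e) (m≤m+n (copies e) (copies f))
copies>0 (mul e f) = <-≤-trans (copies>0 e) (m≤m+n (copies e) (copies f))

eval≤^copies : ∀ {l} → 1 < l → ∀ e → eval l e ≤ l ^ copies e
eval≤^copies {l} 1<l leaf = ≤-reflexive (sym (*-identityʳ l))
eval≤^copies {l} 1<l (add e f) = begin
  eval l e + eval l f          ≤⟨ +-mono-≤ (eval≤^copies 1<l e) (eval≤^copies 1<l f) ⟩
  l ^ copies e + l ^ copies f  ≤⟨ m+n≤m*n (1<l^copies e) (1<l^copies f) ⟩
  l ^ copies e * l ^ copies f  ≡⟨ ^-distribˡ-+-* l (copies e) (copies f) ⟨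
  l ^ (copies e + copies f)    ∎
  where
  open ≤-Reasoning
  1<l^copies : ∀ e → 1 < l ^ copies e
  1<l^copies e = ^-monoʳ-< l 1<l (copies>0 e)
eval≤^copies {l} 1<l (mul e f) = begin
  eval l e * eval l f          ≤⟨ *-mono-≤ (eval≤^copies 1<l e) (eval≤^copies 1<l f) ⟩
  l ^ copies e * l ^ copies f  ≡⟨ ^-distribˡ-+-* l (copies e) (copies f) ⟨
  l ^ (copies e + copies f)    ∎
  where open ≤-Reasoning

expressionsUpTo : ℕ → List Expr
expressionsUpTo zero    = []
expressionsUpTo (suc k) =
  leaf ∷ cartesianProductWith add es es ++ cartesianProductWith mul es es
  where es = expressionsUpTo k

copies-operands≤ : ∀ {k} e f → copies e + copies f ≤ suc k → copies e ≤ k × copies f ≤ k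
copies-operands≤ e f e+f≤1+k =
  s≤s⁻¹ (<-≤-trans (m<m+n (copies e) (copies>0 f)) e+f≤1+k) ,
  s≤s⁻¹ (<-≤-trans (m<n+m (copies f) (copies>0 e)) e+f≤1+k)

∈-expressionsUpTo : ∀ {k} e → copies e ≤ k → e ∈ expressionsUpTo k
∈-expressionsUpTo {zero}  e         e≤0 = contradiction e≤0 (<⇒≱ (copies>0 e))
∈-expressionsUpTo {suc k} leaf      _   = here refl
∈-expressionsUpTo {suc k} (add e f) e+f≤1+k with copies-operands≤ e f e+f≤1+k
... | e≤k , f≤k = there (∈-++⁺ˡ
  (∈-cartesianProductWith⁺ add (∈-expressionsUpTo e e≤k) (∈-expressionsUpTo f f≤k)))
∈-expressionsUpTo {suc k} (mul e f) e+f≤1+k with copies-operands≤ e f e+f≤1+k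
... | e≤k , f≤k = there (∈-++⁺ʳ _
  (∈-cartesianProductWith⁺ mul (∈-expressionsUpTo e e≤k) (∈-expressionsUpTo f f≤k)))

minimal-expression : ∀ {p} {P : Pred Expr p} → Decidable P → ∀ {e₀} → P e₀ →
  Σ Expr λ e → P e × (∀ e′ → P e′ → copies e ≤ copies e′)
minimal-expression {P = P} P? {e₀} Pe₀ =
  best , argmin-all copies Pe₀ (all-filter P? small) , minimal
  where
  small candidates : List Expr
  small      = expressionsUpTo (copies e₀)
  candidates = filter P? small
  best : Expr
  best = argmin copies e₀ candidates
  minimal : ∀ e → P e → copies best ≤ copies e
  minimal e Pe with copies e ≤? copies e₀
  ... | yes e≤e₀ = lookup (f[argmin]≤f[xs] {f = copies} e₀ candidates)
                          (∈-filter⁺ P? (∈-expressionsUpTo e e≤e₀) Pe)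
  ... | no  e≰e₀ = ≤-trans (f[argmin]≤f[⊤] {f = copies} e₀ candidates) (<⇒≤ (≰⇒> e≰e₀))

complexity-exists : ∀ {l n} e₀ → eval l e₀ ≡ n → Σ ℕ (IsComplexity l n)
complexity-exists {l} {n} e₀ e₀≡n with minimal-expression (λ e → eval l e ≟ n) {e₀} e₀≡n
... | e , e≡n , minimal = copies e , (e , e≡n , refl) , minimal

addLeaves : ℕ → Expr → Expr
addLeaves zero    e = e
addLeaves (suc r) e = add leaf (addLeaves r e)

eval-addLeaves : ∀ l r e → eval l (addLeaves r e) ≡ r * l + eval l e
eval-addLeaves l zero    e = refl
eval-addLeaves l (suc r) e =
  trans (cong (l +_) (eval-addLeaves l r e)) (sym (+-assoc l (r * l) (eval l e)))

copies-addLeaves : ∀ r e → copies (addLeaves r e) ≡ r + copies e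
copies-addLeaves zero    e = refl
copies-addLeaves (suc r) e = cong suc (copies-addLeaves r e)

-- The upper bound ‖n‖ ≤ l log_l n − 1, exponentiated and witnessed by e.
Economical : ℕ → ℕ → Expr → Set
Economical l n e = eval l e ≡ n × l ^ suc (copies e) ≤ n ^ l

economical-digit : ∀ {l r} → suc r < l → Economical l (suc r * l) (addLeaves r leaf)
economical-digit {l@(suc _)} {r} 1+r<l =
  trans (eval-addLeaves l r leaf) (+-comm (r * l) l) , (begin
    l ^ suc (copies (addLeaves r leaf))  ≡⟨ cong (λ c → l ^ suc c) (trans (copies-addLeaves r leaf) (+-comm r 1)) ⟩
    l ^ suc (suc r)                      ≤⟨ ^-monoʳ-≤ l 1+r<l ⟩
    l ^ l                                ≤⟨ ^-monoˡ-≤ l (m≤n*m l (suc r)) ⟩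
    (suc r * l) ^ l                      ∎)
  where open ≤-Reasoning

economical-horner : ∀ {l q r e} → r < l → Economical l (q * l) e →
                    Economical l ((r + q * l) * l) (addLeaves r (mul leaf e))
economical-horner {l@(suc _)} {q} {r} {e} r<l (e≡ql , bound) =
  (begin-equality
    eval l (addLeaves r (mul leaf e))  ≡⟨ eval-addLeaves l r (mul leaf e) ⟩
    r * l + l * eval l e              ≡⟨ cong (λ x → r * l + l * x) e≡ql ⟩
    r * l + l * (q * l)               ≡⟨ cong (r * l +_) (*-comm l (q * l)) ⟩
    r * l + q * l * l                 ≡⟨ *-distribʳ-+ l r (q * l) ⟨
    (r + q * l) * l                   ∎) ,
  (begin
    l ^ suc (copies (addLeaves r (mul leaf e)))  ≡⟨ cong (λ c → l ^ suc c) (copies-addLeaves r (mul leaf e)) ⟩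
    l ^ (suc r + suc (copies e))                ≤⟨ ^-monoʳ-≤ l (+-monoˡ-≤ (suc (copies e)) r<l) ⟩
    l ^ (l + suc (copies e))                    ≡⟨ ^-distribˡ-+-* l l (suc (copies e)) ⟩
    l ^ l * l ^ suc (copies e)                  ≤⟨ *-monoʳ-≤ (l ^ l) bound ⟩
    l ^ l * (q * l) ^ l                         ≡⟨ ^-distrib-* l (q * l) l ⟨
    (l * (q * l)) ^ l                           ≤⟨ ^-monoˡ-≤ l (*-monoʳ-≤ l (m≤n+m (q * l) r)) ⟩
    (l * (r + q * l)) ^ l                       ≡⟨ cong (_^ l) (*-comm l (r + q * l)) ⟩
    ((r + q * l) * l) ^ l                       ∎)
  where open ≤-Reasoning

economical-exists : ∀ {l} → 1 < l → ∀ m → 0 < m → ∃ (Economical l (m * l))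
economical-exists {l@(suc _)} 1<l = <-rec _ step
  where
  step : ∀ m → (∀ {q} → q < m → 0 < q → ∃ (Economical l (q * l))) →
         0 < m → ∃ (Economical l (m * l))
  step zero      _  ()
  step m@(suc r) ih _ with m <? l
  ... | yes m<l = addLeaves r leaf , economical-digit m<l
  ... | no  m≮l with ih (m/n<m m l 1<l) (m≥n⇒m/n>0 (≮⇒≥ m≮l))
  ...   | e , economical =
    addLeaves (m % l) (mul leaf e) ,
    subst (λ x → Economical l (x * l) (addLeaves (m % l) (mul leaf e)))
          (sym (m≡m%n+[m/n]*n m l))
          (economical-horner {q = m / l} (m%n<n m l) economical)

complexity-bounds : ∀ {l n k} → 1 < l → IsComplexity l n k → ∀ e → Economical l n e →
                    n ≤ l ^ k × l ^ (k + 1) ≤ n ^ l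
complexity-bounds {l@(suc _)} 1<l ((e₀ , refl , refl) , minimal) e (e≡n , bound) =
  eval≤^copies 1<l e₀ ,
  (begin
    l ^ (copies e₀ + 1)  ≡⟨ cong (l ^_) (+-comm (copies e₀) 1) ⟩
    l ^ suc (copies e₀)  ≤⟨ ^-monoʳ-≤ l (s≤s (minimal e e≡n)) ⟩
    l ^ suc (copies e)   ≤⟨ bound ⟩
    eval l e₀ ^ l        ∎)
  where open ≤-Reasoning

proposition2p1 : (l n : ℕ) → 1 < l → 0 < n → l ∣ n →
    Σ ℕ (λ k → IsComplexity l n k)
    × (∀ (k : ℕ) → IsComplexity l n k → (n ≤ l ^ k) × (l ^ (k + 1) ≤ n ^ l))
proposition2p1 l n 1<l () (divides zero refl)
proposition2p1 l n 1<l _ (divides m@(suc _) refl) with economical-exists 1<l m z<s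
... | e , economical@(e≡n , _) =
  complexity-exists e e≡n , λ k isComplexity → complexity-bounds 1<l isComplexity e economical
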